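{- Let $M = \begin{bmatrix} \alpha & \beta & 0 \\ \gamma & \delta & 0 \\ e & f & 0 \end{bmatrix} \in M_3^0(\mathbb{Z}/2^k\mathbb{Z})$ and suppose $A \equiv B \equiv C \equiv 0 \pmod{2^k}$. (1) If $\gamma$ or $\delta$ is odd, then $\mu(M, k) = 0$. (2) If $\gamma$ and $\delta$ are both even but one of $\alpha, \beta, e, f$ is odd, then $\mu(M, k) = \frac{1}{6 \cdot 64^{k-1}}$.
   Context: $M_3^0(\mathbb{Z}/2^k\mathbb{Z})$ is the set of $3\times 3$ matrices over $\mathbb{Z}/2^k\mathbb{Z}$ with third column zero. For such a matrix $\begin{bmatrix} \alpha & \beta & 0 \\ \gamma & \delta & 0 \\ e & f & 0 \end{bmatrix}$, $A = \gamma f - \delta e$, $B = \alpha f - \beta e$, $C = \alpha\delta - \beta\gamma$. $\mathrm{ord}_2(r)$ is the exponent of the highest power of 2 dividing $r$ (with $\mathrm{ord}_2(0) \ge k$ declared true in $\mathbb{Z}/2^k\mathbb{Z}$). For $M_0 \in M_3^0(\mathbb{Z}/2^r\mathbb{Z})$, $\eta(M_0, r, k) = \#\{ N \in M_3^0(\mathbb{Z}/2^k\mathbb{Z}) : N \equiv M_0 \pmod{2^r},\ \mathrm{ord}_2(A) > \mathrm{ord}_2(B),\ \mathrm{ord}_2(C) > \mathrm{ord}_2(B)\}$ (with $A,B,C$ computed from $N$) and $\mu(M_0, r) = \lim_{k \to \infty} \eta(M_0, r, k)/(8192 \cdot 64^{k-3})$, where $8192$ is the order of the group $I_3$. -}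

module Defs where

open import Data.Nat using (ℕ; zero; suc; _+_; _*_; _∸_; _^_; _<_; _<ᵇ_; NonZero)
open import Data.Nat.Properties using (m*n≢0; m^n≢0)
open import Data.Nat.DivMod using (_/_; _%_)
open import Data.Bool using (Bool; true; false; if_then_else_; _∧_)
open import Data.Integer as ℤ using (ℤ; +_; ∣_∣)
open import Data.Product using (_×_)

-- A matrix [[α, β, 0], [γ, δ, 0], [e, f, 0]] with third column zero,
-- entries given by natural-number representatives.
record Mat0 : Set where
  constructor mat
  field
    α β γ δ e f : ℕ
open Mat0 public

-- M ∈ M_3^0(ℤ/2^k ℤ): all entries are canonical representatives in [0, 2^k).
InRange : ℕ → Mat0 → Set
InRange k M = (α M < 2 ^ k) × (β M < 2 ^ k) × (γ M < 2 ^ k)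
            × (δ M < 2 ^ k) × (e M < 2 ^ k) × (f M < 2 ^ k)

Aᴹ Bᴹ Cᴹ : Mat0 → ℤ
Aᴹ M = (+ γ M) ℤ.* (+ f M) ℤ.- (+ δ M) ℤ.* (+ e M)
Bᴹ M = (+ α M) ℤ.* (+ f M) ℤ.- (+ β M) ℤ.* (+ e M)
Cᴹ M = (+ α M) ℤ.* (+ δ M) ℤ.- (+ β M) ℤ.* (+ γ M)

-- ord K x : the 2-adic order of the class of x in ℤ/2^K ℤ, with the
-- convention ord(0) = K.  Equals min(K, v₂(x)) (and K when x = 0).
ord : ℕ → ℕ → ℕ
ord zero    x = 0
ord (suc K) x = if (x % 2 Data.Nat.≡ᵇ 0) then suc (ord K (x / 2)) else 0

cond : ℕ → Mat0 → Bool
cond K N = (ord K ∣ Bᴹ N ∣ <ᵇ ord K ∣ Aᴹ N ∣) ∧ (ord K ∣ Bᴹ N ∣ <ᵇ ord K ∣ Cᴹ N ∣)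

sumBelow : ℕ → (ℕ → ℕ) → ℕ
sumBelow zero    g = 0
sumBelow (suc n) g = sumBelow n g + g n

-- η(M, k, K): number of N ∈ M_3^0(ℤ/2^K ℤ) with N ≡ M (mod 2^k) satisfying cond.
-- For K ≥ k, such N are exactly the matrices with entries M_i + 2^k t_i, 0 ≤ t_i < 2^(K−k).
η : Mat0 → ℕ → ℕ → ℕ
η M k K =
  sumBelow L λ t₁ → sumBelow L λ t₂ → sumBelow L λ t₃ →
  sumBelow L λ t₄ → sumBelow L λ t₅ → sumBelow L λ t₆ →
  if cond K (mat (α M + q * t₁) (β M + q * t₂) (γ M + q * t₃)
                 (δ M + q * t₄) (e M + q * t₅) (f M + q * t₆))
  then 1 else 0
  where
  L = 2 ^ (K ∸ k)
  q = 2 ^ k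

-- normalising denominator 8192 · 64^(K−3)  (8192 = |I₃|)
den : ℕ → ℕ
den K = 8192 * 64 ^ (K ∸ 3)

den-nz : ∀ K → NonZero (den K)
den-nz K = m*n≢0 8192 (64 ^ (K ∸ 3)) {{_}} {{m^n≢0 64 (K ∸ 3)}}

open import Data.Rational as ℚ using (ℚ; 0ℚ)

ratio : Mat0 → ℕ → ℕ → ℚ
ratio M k K = ℚ._/_ (+ η M k K) (den K) {{den-nz K}}

-- μ(M, k) = v : the sequence ratio M k K converges to v as K → ∞
-- (ε–N definition with rational ε, sufficient since all terms and v are rational).
HasLimit : (ℕ → ℚ) → ℚ → Set
HasLimit s v = ∀ (ε : ℚ) → ℚ.Positive ε →
  Data.Product.∃ λ K₀ → ∀ K → K₀ Data.Nat.≤ K → ℚ.∣ s K ℚ.- v ∣ ℚ.< ε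

μ≡ : Mat0 → ℕ → ℚ → Set
μ≡ M k v = HasLimit (ratio M k) v

target : ℕ → ℚ
target k = ℚ._/_ (+ 1) (6 * 64 ^ (k ∸ 1)) {{m*n≢0 6 (64 ^ (k ∸ 1)) {{_}} {{m^n≢0 64 (k ∸ 1)}}}}

Odd : ℕ → Set
Odd x = x % 2 Relation.Binary.PropositionalEquality.≡ 1
  where import Relation.Binary.PropositionalEquality

Even : ℕ → Set
Even x = x % 2 Relation.Binary.PropositionalEquality.≡ 0
  where import Relation.Binary.PropositionalEquality

module Submission where

-- Theorem 5.4: densities μ(M, k) for M ∈ M₃⁰(ℤ/2^k) whose minors A, B, C all
-- vanish mod 2^k.  Every lift N of M satisfies γ·B = α·A + e·C, δ·B = β·A + f·C
-- and α·A = γ·B − e·C.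
--
-- (1) If γ (or δ) is odd in M, it is odd in every lift; the 2-adic order is
--     ultrametric, so ord B ≥ min(ord A, ord C), no lift is counted, and μ = 0.
-- (2) Otherwise an entry among α, β, e, f is odd; swapping the columns and/or
--     rows 1 and 3 preserves η and the hypotheses and moves it to position α.
--     With α odd and γ even, the minors of a lift are 2^k·(Z, X, Y) and the
--     condition becomes ord X < ord Y.  As the lift parameters t₆, t₄ run over
--     ℤ/2^n, X and Y run over progressions with odd step α + 2^k·t₁, whose orders
--     are equidistributed; hence η = 2^(4n)·#{(X, Y) : ord X < ord Y}, and this
--     number F satisfies 3F + 1 = 4^n.

open import Defs
open import Data.Nat using (ℕ; _^_)
open import Data.Integer using (+_)
open import Data.Integer.Divisibility using (_∣_)
open import Data.Product using (_×_)
open import Data.Sum using (_⊎_)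
open import Data.Rational using (0ℚ)

import Algebra.Properties.CommutativeSemigroup as CSemigroup
open import Data.Bool using (Bool; true; false; if_then_else_; _∧_; T)
import Data.Bool.Properties
open import Data.Empty using (⊥; ⊥-elim)
open import Data.Integer as Int using (ℤ; -[1+_]; +[1+_]; ∣_∣; -_)
open import Data.Integer.Divisibility.Signed as Signed using (divides) renaming (_∣_ to _∣ˢ_)
import Data.Integer.DivMod as IntDivMod
import Data.Integer.GCD as IntGCD
import Data.Integer.Properties as IntP
open import Data.Integer.Tactic.RingSolver using (solve-∀)
open import Data.Nat as Nat using (zero; suc; _≤_; _<_; z≤n; s≤s; _<ᵇ_)
import Data.Nat.DivMod as NatDivMod
import Data.Nat.Divisibility as NatDivisibility
import Data.Nat.Properties as NatP
import Data.Nat.Tactic.RingSolver as NatSolver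
open import Data.Product using (_,_; Σ; proj₁; proj₂)
import Data.Rational as Rat
open Rat using (ℚ; toℚᵘ)
import Data.Rational.Properties as RatP
import Data.Rational.Unnormalised as Ratᵘ
open Ratᵘ using (mkℚᵘ) renaming (_≃_ to _≃ᵘ_)
import Data.Rational.Unnormalised.Properties as RatᵘP
open import Data.Sum using (inj₁; inj₂; [_,_]′)
open import Function using (_∘_; _⇔_; mk⇔; Equivalence)
open import Relation.Binary.PropositionalEquality

module _ where
  open Nat using (_+_; _*_)

  sum-cong : ∀ n {f g : ℕ → ℕ} → (∀ i → f i ≡ g i) → sumBelow n f ≡ sumBelow n g
  sum-cong zero    f≗g = refl
  sum-cong (suc n) f≗g = cong₂ _+_ (sum-cong n f≗g) (f≗g n)

  sum-const : ∀ n c → sumBelow n (λ _ → c) ≡ n * c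
  sum-const zero    c = refl
  sum-const (suc n) c = trans (cong (_+ c) (sum-const n c)) (NatP.+-comm (n * c) c)

  sum-zero : ∀ n {f : ℕ → ℕ} → (∀ i → f i ≡ 0) → sumBelow n f ≡ 0
  sum-zero n f≗0 = trans (sum-cong n f≗0) (trans (sum-const n 0) (NatP.*-zeroʳ n))

  sum-+ : ∀ n (f g : ℕ → ℕ) → sumBelow n (λ i → f i + g i) ≡ sumBelow n f + sumBelow n g
  sum-+ zero    f g = refl
  sum-+ (suc n) f g = trans (cong (_+ (f n + g n)) (sum-+ n f g))
    (CSemigroup.interchange NatP.+-commutativeSemigroup (sumBelow n f) (sumBelow n g) (f n) (g n))

  sum-swap : ∀ n m (g : ℕ → ℕ → ℕ) →
    sumBelow n (λ a → sumBelow m (g a)) ≡ sumBelow m (λ b → sumBelow n (λ a → g a b))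
  sum-swap zero    m g = sym (sum-zero m (λ _ → refl))
  sum-swap (suc n) m g = trans (cong (_+ sumBelow m (g n)) (sum-swap n m g))
    (sym (sum-+ m (λ b → sumBelow n (λ a → g a b)) (g n)))

  sum-evenOdd : ∀ m (h : ℕ → ℕ) →
    sumBelow (2 * m) h ≡ sumBelow m (λ s → h (2 * s) + h (suc (2 * s)))
  sum-evenOdd zero    h = refl
  sum-evenOdd (suc m) h = begin
    sumBelow (2 * suc m) h                                    ≡⟨ cong (λ w → sumBelow w h) (NatP.*-suc 2 m) ⟩
    sumBelow (2 * m) h + h (2 * m) + h (suc (2 * m))          ≡⟨ cong (λ w → w + h (2 * m) + h (suc (2 * m))) (sum-evenOdd m h) ⟩
    sumBelow m pairs + h (2 * m) + h (suc (2 * m))            ≡⟨ NatP.+-assoc (sumBelow m pairs) (h (2 * m)) (h (suc (2 * m))) ⟩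
    sumBelow (suc m) pairs                                    ∎
    where
    open ≡-Reasoning
    pairs : ℕ → ℕ
    pairs s = h (2 * s) + h (suc (2 * s))

-- Parity and the truncated 2-adic order `ord`.

module _ where
  open Int using (_+_; _*_; _-_)

  data Parity (z : ℤ) : Set where
    even : ∀ y → z ≡ y * + 2 → Parity z
    odd  : ∀ y → z ≡ + 1 + y * + 2 → Parity z

  parity : ∀ z → Parity z
  parity z = classify (z Int.% + 2) (IntDivMod.a≡a%n+[a/n]*n z (+ 2)) (IntDivMod.n%d<d z (+ 2))
    where
    classify : ∀ r → z ≡ + r + (z Int./ + 2) * + 2 → r < 2 → Parity z
    classify zero          eq _ = even (z Int./ + 2) (trans eq (IntP.+-identityˡ _))
    classify (suc zero)    eq _ = odd (z Int./ + 2) eq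
    classify (suc (suc _)) _  (s≤s (s≤s ()))

  Oddℤ Evenℤ : ℤ → Set
  Oddℤ  z = Σ ℤ λ y → z ≡ + 1 + y * + 2
  Evenℤ z = Σ ℤ λ y → z ≡ y * + 2

  odd-pos : ∀ {x} h → x ≡ 1 Nat.+ h Nat.* 2 → Oddℤ (+ x)
  odd-pos h refl = + h , trans (IntP.pos-+ 1 (h Nat.* 2)) (cong (_+_ (+ 1)) (IntP.pos-* h 2))

  even-pos : ∀ {x} h → x ≡ h Nat.* 2 → Evenℤ (+ x)
  even-pos h refl = + h , IntP.pos-* h 2

  P2 : ℕ → ℤ
  P2 i = + (2 ^ i)

  P2-suc : ∀ i → P2 (suc i) ≡ P2 i * + 2
  P2-suc i = trans (IntP.pos-* 2 (2 ^ i)) (IntP.*-comm (+ 2) (P2 i))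

  ord-double : ∀ n y → ord (suc n) ∣ y * + 2 ∣ ≡ suc (ord n ∣ y ∣)
  ord-double n y rewrite IntP.abs-* y (+ 2)
                       | NatDivMod.m*n%n≡0 ∣ y ∣ 2 {{_}} | NatDivMod.m*n/n≡m ∣ y ∣ 2 {{_}} = refl

  ord-odd : ∀ n y → ord (suc n) ∣ + 1 + y * + 2 ∣ ≡ 0
  ord-odd n (+ m) rewrite sym (IntP.pos-* m 2) | NatDivMod.[m+kn]%n≡m%n 1 m 2 {{_}} = refl
  ord-odd n -[1+ m ] = begin
    ord (suc n) ∣ + 1 + -[1+ m ] * + 2 ∣        ≡⟨ cong (ord (suc n) ∘ ∣_∣) (negate-odd (+ m)) ⟩
    ord (suc n) ∣ - (+ 1 + + m * + 2) ∣         ≡⟨ cong (ord (suc n)) (IntP.∣-i∣≡∣i∣ (+ 1 + + m * + 2)) ⟩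
    ord (suc n) ∣ + 1 + + m * + 2 ∣             ≡⟨ ord-odd n (+ m) ⟩
    0                                           ∎
    where
    open ≡-Reasoning
    negate-odd : ∀ x → + 1 + (- (+ 1 + x)) * + 2 ≡ - (+ 1 + x * + 2)
    negate-odd = solve-∀

  ord-≤ : ∀ n x → ord n x ≤ n
  ord-≤ zero    x = z≤n
  ord-≤ (suc n) x with x Nat.% 2 Nat.≡ᵇ 0
  ... | true  = s≤s (ord-≤ n (x Nat./ 2))
  ... | false = z≤n

  odd≢even : ∀ y w → + 1 + y * + 2 ≢ w * + 2
  odd≢even y w eq = NatP.0≢1+n (trans (sym (ord-odd 0 y)) (trans (cong (ord 1 ∘ ∣_∣) eq) (ord-double 0 w)))

  pow2∣-double : ∀ i {x} → P2 i ∣ˢ x → P2 (suc i) ∣ˢ x * + 2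
  pow2∣-double i 2ⁱ∣x = subst (_∣ˢ _) (sym (P2-suc i)) (Signed.*-monoˡ-∣ (+ 2) 2ⁱ∣x)

  pow2∣⇔≤ord : ∀ n i → i ≤ n → ∀ z → P2 i ∣ˢ z ⇔ i ≤ ord n ∣ z ∣
  pow2∣⇔≤ord n       zero    _         z = mk⇔ (λ _ → z≤n) (λ _ → divides z (sym (IntP.*-identityʳ z)))
  pow2∣⇔≤ord (suc n) (suc i) (s≤s i≤n) z with parity z
  ... | even y refl rewrite ord-double n y = mk⇔
          (λ 2ⁱ⁺¹∣z → s≤s (Equivalence.to IH (Signed.*-cancelʳ-∣ (+ 2) (subst (_∣ˢ y * + 2) (P2-suc i) 2ⁱ⁺¹∣z))))
          (λ { (s≤s i≤ord) → pow2∣-double i (Equivalence.from IH i≤ord) })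
    where IH = pow2∣⇔≤ord n i i≤n y
  ... | odd y refl rewrite ord-odd n y = mk⇔ (λ { (divides w eq) → ⊥-elim (odd≢even y (w * P2 i) (trans eq (regroup w))) }) (λ ())
    where
    regroup : ∀ w → w * P2 (suc i) ≡ w * P2 i * + 2
    regroup w = trans (cong (w *_) (P2-suc i)) (sym (IntP.*-assoc w (P2 i) (+ 2)))

  ord-oddFactor : ∀ n a z → Oddℤ a → ord n ∣ a * z ∣ ≡ ord n ∣ z ∣
  ord-oddFactor zero    a z _ = refl
  ord-oddFactor (suc n) a z (c , refl) with parity z
  ... | even y refl = begin
    ord (suc n) ∣ a * (y * + 2) ∣   ≡⟨ cong (ord (suc n) ∘ ∣_∣) (IntP.*-assoc a y (+ 2)) ⟨
    ord (suc n) ∣ a * y * + 2 ∣     ≡⟨ ord-double n (a * y) ⟩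
    suc (ord n ∣ a * y ∣)           ≡⟨ cong suc (ord-oddFactor n a y (c , refl)) ⟩
    suc (ord n ∣ y ∣)               ≡⟨ ord-double n y ⟨
    ord (suc n) ∣ y * + 2 ∣         ∎
    where open ≡-Reasoning
  ... | odd y refl = trans (cong (ord (suc n) ∘ ∣_∣) (odd*odd c y))
                           (trans (ord-odd n (c + y + c * y * + 2)) (sym (ord-odd n y)))
    where
    odd*odd : ∀ c y → (+ 1 + c * + 2) * (+ 1 + y * + 2) ≡ + 1 + (c + y + c * y * + 2) * + 2
    odd*odd = solve-∀

  ord-shift : ∀ k n X → ord (k Nat.+ n) ∣ P2 k * X ∣ ≡ k Nat.+ ord n ∣ X ∣
  ord-shift zero    n X = cong (ord n ∘ ∣_∣) (IntP.*-identityˡ X)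
  ord-shift (suc k) n X = begin
    ord (suc k Nat.+ n) ∣ P2 (suc k) * X ∣    ≡⟨ cong (ord (suc k Nat.+ n) ∘ ∣_∣) (trans (cong (_* X) (P2-suc k)) (regroup (P2 k) X)) ⟩
    ord (suc k Nat.+ n) ∣ P2 k * X * + 2 ∣    ≡⟨ ord-double (k Nat.+ n) (P2 k * X) ⟩
    suc (ord (k Nat.+ n) ∣ P2 k * X ∣)        ≡⟨ cong suc (ord-shift k n X) ⟩
    suc k Nat.+ ord n ∣ X ∣                   ∎
    where
    open ≡-Reasoning
    regroup : ∀ p X → p * + 2 * X ≡ p * X * + 2
    regroup = solve-∀

  module Above (n i : ℕ) (i<n : i < n) where
    above⇒pow2∣ : ∀ z → i < ord n ∣ z ∣ → P2 (suc i) ∣ˢ z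
    above⇒pow2∣ z = Equivalence.from (pow2∣⇔≤ord n (suc i) i<n z)

    pow2∣⇒above : ∀ z → P2 (suc i) ∣ˢ z → i < ord n ∣ z ∣
    pow2∣⇒above z = Equivalence.to (pow2∣⇔≤ord n (suc i) i<n z)

  no-strict-minimum : ∀ n a g e A B C → Oddℤ g → g * B ≡ a * A + e * C →
    ord n ∣ B ∣ < ord n ∣ A ∣ → ord n ∣ B ∣ < ord n ∣ C ∣ → ⊥
  no-strict-minimum n a g e A B C g-odd eq B<A B<C =
    NatP.<-irrefl refl (subst (i <_) (ord-oddFactor n g B g-odd) i<ord[gB])
    where
    i = ord n ∣ B ∣
    open Above n i (NatP.<-≤-trans B<A (ord-≤ n ∣ A ∣))
    i<ord[gB] : i < ord n ∣ g * B ∣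
    i<ord[gB] = pow2∣⇒above (g * B) (subst (P2 (suc i) ∣ˢ_) (sym eq)
      (Signed.∣m∣n⇒∣m+n (Signed.∣n⇒∣m*n a (above⇒pow2∣ A B<A)) (Signed.∣n⇒∣m*n e (above⇒pow2∣ C B<C))))

  order-inherited : ∀ n a g e X Y Z → Oddℤ a → Evenℤ g → a * Z ≡ g * X - e * Y →
    ord n ∣ X ∣ < ord n ∣ Y ∣ → ord n ∣ X ∣ < ord n ∣ Z ∣
  order-inherited n a g e X Y Z a-odd (h , refl) eq X<Y =
    subst (i <_) (ord-oddFactor n a Z a-odd) (pow2∣⇒above (a * Z) (subst (P2 (suc i) ∣ˢ_) (sym eq)
      (Signed.∣m∣n⇒∣m-n 2ⁱ⁺¹∣gX (Signed.∣n⇒∣m*n e (above⇒pow2∣ Y X<Y)))))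
    where
    i = ord n ∣ X ∣
    i<n : i < n
    i<n = NatP.<-≤-trans X<Y (ord-≤ n ∣ Y ∣)
    open Above n i i<n
    reassoc : h * + 2 * X ≡ h * (X * + 2)
    reassoc = trans (IntP.*-assoc h (+ 2) X) (cong (h *_) (IntP.*-comm (+ 2) X))
    2ⁱ⁺¹∣gX : P2 (suc i) ∣ˢ h * + 2 * X
    2ⁱ⁺¹∣gX = subst (P2 (suc i) ∣ˢ_) (sym reassoc)
      (Signed.∣n⇒∣m*n h (pow2∣-double i (Equivalence.from (pow2∣⇔≤ord n i (NatP.<⇒≤ i<n) X) NatP.≤-refl)))

-- The distribution of `ord` along a progression with odd step.

-- ordWeight n g = Σ_{a<n} 2^(n−1−a)·g a + g n: the sum of g (ord n z) over
-- z ∈ ℤ/2^n, grouped by the value a of the order (2^(n−1−a) residues have order a < n).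
ordWeight : ℕ → (ℕ → ℕ) → ℕ
ordWeight zero    g = g 0
ordWeight (suc n) g = 2 ^ n Nat.* g 0 Nat.+ ordWeight n (g ∘ suc)

module _ where
  open Int using (_+_; _*_)

  +2s : ∀ s → + (2 Nat.* s) ≡ + 2 * + s
  +2s s = IntP.pos-* 2 s

  +2s+1 : ∀ s → + suc (2 Nat.* s) ≡ + 1 + + 2 * + s
  +2s+1 s = trans (IntP.pos-+ 1 (2 Nat.* s)) (cong (_+_ (+ 1)) (+2s s))

  -- Halving an odd-step progression x + u·s, u = 1 + 2c: of the terms with indices
  -- 2s and 2s+1, one is odd and the other is twice x' + u·s for a fixed x'.
  halve : ∀ x c → Σ ℤ λ x' → ∀ n (g : ℕ → ℕ) s →
    g (ord (suc n) ∣ x + (+ 1 + c * + 2) * + (2 Nat.* s) ∣) Nat.+ g (ord (suc n) ∣ x + (+ 1 + c * + 2) * + suc (2 Nat.* s) ∣)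
      ≡ g (suc (ord n ∣ x' + (+ 1 + c * + 2) * + s ∣)) Nat.+ g 0
  halve x c with parity x
  ... | even y refl = y , λ n g s → cong₂ Nat._+_
    (cong g (trans (cong (ord (suc n) ∘ ∣_∣) (even-index s)) (ord-double n (y + u * + s))))
    (cong g (trans (cong (ord (suc n) ∘ ∣_∣) (odd-index s)) (ord-odd n (y + c + u * + s))))
    where
    u = + 1 + c * + 2
    even-index : ∀ s → y * + 2 + u * + (2 Nat.* s) ≡ (y + u * + s) * + 2
    even-index s = trans (cong (λ w → y * + 2 + u * w) (+2s s)) (ring y c (+ s))
      where ring : ∀ y c s → y * + 2 + (+ 1 + c * + 2) * (+ 2 * s) ≡ (y + (+ 1 + c * + 2) * s) * + 2
            ring = solve-∀
    odd-index : ∀ s → y * + 2 + u * + suc (2 Nat.* s) ≡ + 1 + (y + c + u * + s) * + 2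
    odd-index s = trans (cong (λ w → y * + 2 + u * w) (+2s+1 s)) (ring y c (+ s))
      where ring : ∀ y c s → y * + 2 + (+ 1 + c * + 2) * (+ 1 + + 2 * s) ≡ + 1 + (y + c + (+ 1 + c * + 2) * s) * + 2
            ring = solve-∀
  ... | odd y refl = + 1 + y + c , λ n g s → trans (cong₂ Nat._+_
    (cong g (trans (cong (ord (suc n) ∘ ∣_∣) (even-index s)) (ord-odd n (y + u * + s))))
    (cong g (trans (cong (ord (suc n) ∘ ∣_∣) (odd-index s)) (ord-double n (+ 1 + y + c + u * + s)))))
    (NatP.+-comm (g 0) _)
    where
    u = + 1 + c * + 2
    even-index : ∀ s → + 1 + y * + 2 + u * + (2 Nat.* s) ≡ + 1 + (y + u * + s) * + 2
    even-index s = trans (cong (λ w → + 1 + y * + 2 + u * w) (+2s s)) (ring y c (+ s))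
      where ring : ∀ y c s → + 1 + y * + 2 + (+ 1 + c * + 2) * (+ 2 * s) ≡ + 1 + (y + (+ 1 + c * + 2) * s) * + 2
            ring = solve-∀
    odd-index : ∀ s → + 1 + y * + 2 + u * + suc (2 Nat.* s) ≡ (+ 1 + y + c + u * + s) * + 2
    odd-index s = trans (cong (λ w → + 1 + y * + 2 + u * w) (+2s+1 s)) (ring y c (+ s))
      where ring : ∀ y c s → + 1 + y * + 2 + (+ 1 + c * + 2) * (+ 1 + + 2 * s) ≡ (+ 1 + y + c + (+ 1 + c * + 2) * s) * + 2
            ring = solve-∀

  sum-ord-progression : ∀ n (g : ℕ → ℕ) x u → Oddℤ u →
    sumBelow (2 ^ n) (λ s → g (ord n ∣ x + u * + s ∣)) ≡ ordWeight n g
  sum-ord-progression zero    g x u _       = refl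
  sum-ord-progression (suc n) g x u (c , refl) = begin
    sumBelow (2 Nat.* 2 ^ n) (λ s → g (ord (suc n) ∣ x + u * + s ∣))
      ≡⟨ sum-evenOdd (2 ^ n) _ ⟩
    sumBelow (2 ^ n) (λ s → g (ord (suc n) ∣ x + u * + (2 Nat.* s) ∣) Nat.+ g (ord (suc n) ∣ x + u * + suc (2 Nat.* s) ∣))
      ≡⟨ sum-cong (2 ^ n) (proj₂ (halve x c) n g) ⟩
    sumBelow (2 ^ n) (λ s → g (suc (ord n ∣ x' + u * + s ∣)) Nat.+ g 0)
      ≡⟨ sum-+ (2 ^ n) _ _ ⟩
    sumBelow (2 ^ n) (λ s → g (suc (ord n ∣ x' + u * + s ∣))) Nat.+ sumBelow (2 ^ n) (λ _ → g 0)
      ≡⟨ cong₂ Nat._+_ (sum-ord-progression n (g ∘ suc) x' u (c , refl)) (sum-const (2 ^ n) (g 0)) ⟩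
    ordWeight n (g ∘ suc) Nat.+ 2 ^ n Nat.* g 0
      ≡⟨ NatP.+-comm (ordWeight n (g ∘ suc)) _ ⟩
    ordWeight (suc n) g ∎
    where
    open ≡-Reasoning
    x' = proj₁ (halve x c)

module _ where
  open Nat using (_+_; _*_)

  ordWeight-const : ∀ n c → ordWeight n (λ _ → c) ≡ 2 ^ n * c
  ordWeight-const zero    c = sym (NatP.+-identityʳ c)
  ordWeight-const (suc n) c = trans (cong (_+_ (2 ^ n * c)) (ordWeight-const n c))
    (sym (trans (NatP.*-assoc 2 (2 ^ n) c) (cong (_+_ (2 ^ n * c)) (NatP.+-identityʳ (2 ^ n * c)))))

  ordWeight-+ : ∀ n (g h : ℕ → ℕ) → ordWeight n (λ a → g a + h a) ≡ ordWeight n g + ordWeight n h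
  ordWeight-+ zero    g h = refl
  ordWeight-+ (suc n) g h =
    trans (cong₂ _+_ (NatP.*-distribˡ-+ (2 ^ n) (g 0) (h 0)) (ordWeight-+ n (g ∘ suc) (h ∘ suc)))
          (CSemigroup.interchange NatP.+-commutativeSemigroup (2 ^ n * g 0) (2 ^ n * h 0) _ _)

  ordWeight-scale : ∀ n m (g : ℕ → ℕ) → ordWeight n (λ a → m * g a) ≡ m * ordWeight n g
  ordWeight-scale zero    m g = refl
  ordWeight-scale (suc n) m g =
    trans (cong₂ _+_ (CSemigroup.x∙yz≈y∙xz NatP.*-commutativeSemigroup (2 ^ n) m (g 0)) (ordWeight-scale n m (g ∘ suc)))
          (sym (NatP.*-distribˡ-+ m _ _))

-- Counting pairs of residues by order.

module _ where
  open Nat using (_+_; _*_)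

  𝟙 : Bool → ℕ
  𝟙 b = if b then 1 else 0

  -- countBelow n c = #{z ∈ ℤ/2^n : ord z < c}.
  countBelow : ℕ → ℕ → ℕ
  countBelow n c = ordWeight n (λ a → 𝟙 (a <ᵇ c))

  -- orderedPairs n = #{(X, Y) ∈ (ℤ/2^n)² : ord X < ord Y}.
  orderedPairs : ℕ → ℕ
  orderedPairs n = ordWeight n (countBelow n)

  -- Splitting off the pairs with ord Y = 0 (none) and ord X = 0 < ord Y (2^n·2^n of them).
  orderedPairs-suc : ∀ n → orderedPairs (suc n) ≡ 2 ^ n * 2 ^ n + orderedPairs n
  orderedPairs-suc n = cong₂ _+_ none-below-0 (begin
    ordWeight n (λ c → 2 ^ n * 1 + countBelow n c)              ≡⟨ ordWeight-+ n (λ _ → 2 ^ n * 1) (countBelow n) ⟩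
    ordWeight n (λ _ → 2 ^ n * 1) + orderedPairs n              ≡⟨ cong (_+ orderedPairs n) (ordWeight-const n (2 ^ n * 1)) ⟩
    2 ^ n * (2 ^ n * 1) + orderedPairs n                        ≡⟨ cong (λ w → 2 ^ n * w + orderedPairs n) (NatP.*-identityʳ (2 ^ n)) ⟩
    2 ^ n * 2 ^ n + orderedPairs n                              ∎)
    where
    open ≡-Reasoning
    none-below-0 : 2 ^ n * countBelow (suc n) 0 ≡ 0
    none-below-0 = trans (cong (2 ^ n *_) (trans (cong (_+_ (2 ^ n * 0)) (ordWeight-const n 0))
                     (cong₂ _+_ (NatP.*-zeroʳ (2 ^ n)) (NatP.*-zeroʳ (2 ^ n)))))
                     (NatP.*-zeroʳ (2 ^ n))

  orderedPairs-closed : ∀ n → 3 * orderedPairs n + 1 ≡ 2 ^ n * 2 ^ n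
  orderedPairs-closed zero    = refl
  orderedPairs-closed (suc n) = begin
    3 * orderedPairs (suc n) + 1                  ≡⟨ cong (λ w → 3 * w + 1) (orderedPairs-suc n) ⟩
    3 * (2 ^ n * 2 ^ n + orderedPairs n) + 1      ≡⟨ regroup (2 ^ n) (orderedPairs n) ⟩
    3 * (2 ^ n * 2 ^ n) + (3 * orderedPairs n + 1) ≡⟨ cong (_+_ (3 * (2 ^ n * 2 ^ n))) (orderedPairs-closed n) ⟩
    3 * (2 ^ n * 2 ^ n) + 2 ^ n * 2 ^ n           ≡⟨ quadruple (2 ^ n) ⟩
    2 ^ suc n * 2 ^ suc n                         ∎
    where
    open ≡-Reasoning
    regroup : ∀ x F → 3 * (x * x + F) + 1 ≡ 3 * (x * x) + (3 * F + 1)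
    regroup = NatSolver.solve-∀
    quadruple : ∀ x → 3 * (x * x) + x * x ≡ 2 * x * (2 * x)
    quadruple = NatSolver.solve-∀

lift : Mat0 → ℕ → ℕ → ℕ → ℕ → ℕ → ℕ → ℕ → Mat0
lift M q t₁ t₂ t₃ t₄ t₅ t₆ = mat (α M Nat.+ q Nat.* t₁) (β M Nat.+ q Nat.* t₂) (γ M Nat.+ q Nat.* t₃)
                                 (δ M Nat.+ q Nat.* t₄) (e M Nat.+ q Nat.* t₅) (f M Nat.+ q Nat.* t₆)

counted : Mat0 → ℕ → ℕ → ℕ → ℕ → ℕ → ℕ → ℕ → ℕ → ℕ
counted M k K t₁ t₂ t₃ t₄ t₅ t₆ = 𝟙 (cond K (lift M (2 ^ k) t₁ t₂ t₃ t₄ t₅ t₆))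

Sum⁶ : ℕ → (ℕ → ℕ → ℕ → ℕ → ℕ → ℕ → ℕ) → ℕ
Sum⁶ L h = sumBelow L λ t₁ → sumBelow L λ t₂ → sumBelow L λ t₃ →
           sumBelow L λ t₄ → sumBelow L λ t₅ → sumBelow L λ t₆ → h t₁ t₂ t₃ t₄ t₅ t₆

module _ where
  open Nat using (_+_; _*_)

  lift-halves : ∀ k x t → x + 2 ^ suc k * t ≡ x Nat.% 2 + (x Nat./ 2 + 2 ^ k * t) * 2
  lift-halves k x t = trans (cong (_+ 2 ^ suc k * t) (NatDivMod.m≡m%n+[m/n]*n x 2)) (regroup (x Nat.% 2) (x Nat./ 2) (2 ^ k) t)
    where regroup : ∀ r h p t → r + h * 2 + 2 * p * t ≡ r + (h + p * t) * 2
          regroup = NatSolver.solve-∀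

  lift-odd : ∀ k x t → Odd x → Oddℤ (+ (x + 2 ^ suc k * t))
  lift-odd k x t x-odd = odd-pos (x Nat./ 2 + 2 ^ k * t) (trans (lift-halves k x t) (cong (_+ (x Nat./ 2 + 2 ^ k * t) * 2) x-odd))

  lift-even : ∀ k x t → Even x → Evenℤ (+ (x + 2 ^ suc k * t))
  lift-even k x t x-even = even-pos (x Nat./ 2 + 2 ^ k * t) (trans (lift-halves k x t) (cong (_+ (x Nat./ 2 + 2 ^ k * t) * 2) x-even))

-- Part (1): an odd entry in the middle row makes the condition impossible.

<ᵇ-true⇒< : ∀ {m n} → (m <ᵇ n) ≡ true → m < n
<ᵇ-true⇒< {m} {n} eq = NatP.<ᵇ⇒< m n (subst T (sym eq) _)

cond-false : ∀ K N → (ord K ∣ Bᴹ N ∣ < ord K ∣ Aᴹ N ∣ → ord K ∣ Bᴹ N ∣ < ord K ∣ Cᴹ N ∣ → ⊥) →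
  cond K N ≡ false
cond-false K N impossible with ord K ∣ Bᴹ N ∣ <ᵇ ord K ∣ Aᴹ N ∣ in B<A
... | false = refl
... | true with ord K ∣ Bᴹ N ∣ <ᵇ ord K ∣ Cᴹ N ∣ in B<C
...   | false = refl
...   | true  = ⊥-elim (impossible (<ᵇ-true⇒< B<A) (<ᵇ-true⇒< B<C))

module _ where
  open Int using (_+_; _*_; _-_)

  minor-relation-γ : ∀ N → + γ N * Bᴹ N ≡ + α N * Aᴹ N + + e N * Cᴹ N
  minor-relation-γ N = ring (+ α N) (+ β N) (+ γ N) (+ δ N) (+ e N) (+ f N)
    where ring : ∀ a b g d e f → g * (a * f - b * e) ≡ a * (g * f - d * e) + e * (a * d - b * g)
          ring = solve-∀

  minor-relation-δ : ∀ N → + δ N * Bᴹ N ≡ + β N * Aᴹ N + + f N * Cᴹ N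
  minor-relation-δ N = ring (+ α N) (+ β N) (+ γ N) (+ δ N) (+ e N) (+ f N)
    where ring : ∀ a b g d e f → d * (a * f - b * e) ≡ b * (g * f - d * e) + f * (a * d - b * g)
          ring = solve-∀

η-vanishes : ∀ k M K → Odd (γ M) ⊎ Odd (δ M) → η M (suc k) K ≡ 0
η-vanishes k M K γδ-odd = sum-zero L λ t₁ → sum-zero L λ t₂ → sum-zero L λ t₃ →
  sum-zero L λ t₄ → sum-zero L λ t₅ → sum-zero L λ t₆ →
  cong 𝟙 (vanishes (lift M (2 ^ suc k) t₁ t₂ t₃ t₄ t₅ t₆) (odd-lifted γδ-odd t₃ t₄))
  where
  L = 2 ^ (K Nat.∸ suc k)
  odd-lifted : Odd (γ M) ⊎ Odd (δ M) → ∀ t₃ t₄ →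
    Oddℤ (+ (γ M Nat.+ 2 ^ suc k Nat.* t₃)) ⊎ Oddℤ (+ (δ M Nat.+ 2 ^ suc k Nat.* t₄))
  odd-lifted (inj₁ γ-odd) t₃ t₄ = inj₁ (lift-odd k (γ M) t₃ γ-odd)
  odd-lifted (inj₂ δ-odd) t₃ t₄ = inj₂ (lift-odd k (δ M) t₄ δ-odd)
  vanishes : ∀ N → Oddℤ (+ γ N) ⊎ Oddℤ (+ δ N) → cond K N ≡ false
  vanishes N (inj₁ γ-odd) = cond-false K N (no-strict-minimum K (+ α N) (+ γ N) (+ e N) (Aᴹ N) (Bᴹ N) (Cᴹ N) γ-odd (minor-relation-γ N))
  vanishes N (inj₂ δ-odd) = cond-false K N (no-strict-minimum K (+ β N) (+ δ N) (+ f N) (Aᴹ N) (Bᴹ N) (Cᴹ N) δ-odd (minor-relation-δ N))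

-- Part (2): the condition on a lift when α is odd and γ even.

+-<ᵇ : ∀ k a b → (k Nat.+ a <ᵇ k Nat.+ b) ≡ (a <ᵇ b)
+-<ᵇ zero    a b = refl
+-<ᵇ (suc k) a b = +-<ᵇ k a b

<ᵇ-∧-redundant : ∀ x y z → (x < y → x < z) → ((x <ᵇ z) ∧ (x <ᵇ y)) ≡ (x <ᵇ y)
<ᵇ-∧-redundant x y z implied with x <ᵇ y in x<y
... | false = Data.Bool.Properties.∧-zeroʳ (x <ᵇ z)
... | true  = cong (_∧ true) (T⇒≡true (NatP.<⇒<ᵇ (implied (<ᵇ-true⇒< x<y))))
  where
  T⇒≡true : ∀ {b} → T b → b ≡ true
  T⇒≡true {true} _ = refl

module _ where
  open Int using (_+_; _*_; _-_)

  minor-relation-α : ∀ N → + α N * Aᴹ N ≡ + γ N * Bᴹ N - + e N * Cᴹ N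
  minor-relation-α N = ring (+ α N) (+ β N) (+ γ N) (+ δ N) (+ e N) (+ f N)
    where ring : ∀ a b g d e f → a * (g * f - d * e) ≡ g * (a * f - b * e) - e * (a * d - b * g)
          ring = solve-∀

  -- With α odd and γ even, and minors A, B, C = 2^k·(Z, X, Y), the condition at
  -- level k + n reduces to ord X < ord Y (ord Z > ord X then follows).
  cond-reduces : ∀ k n N X Y Z → Oddℤ (+ α N) → Evenℤ (+ γ N) →
    Aᴹ N ≡ P2 k * Z → Bᴹ N ≡ P2 k * X → Cᴹ N ≡ P2 k * Y →
    cond (k Nat.+ n) N ≡ (ord n ∣ X ∣ <ᵇ ord n ∣ Y ∣)
  cond-reduces k n N X Y Z α-odd γ-even A≡ B≡ C≡ = begin
    cond (k Nat.+ n) N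
      ≡⟨ cong₂ _∧_ (cong₂ _<ᵇ_ (shifted B≡) (shifted A≡)) (cong₂ _<ᵇ_ (shifted B≡) (shifted C≡)) ⟩
    (k Nat.+ ord n ∣ X ∣ <ᵇ k Nat.+ ord n ∣ Z ∣) ∧ (k Nat.+ ord n ∣ X ∣ <ᵇ k Nat.+ ord n ∣ Y ∣)
      ≡⟨ cong₂ _∧_ (+-<ᵇ k _ _) (+-<ᵇ k _ _) ⟩
    (ord n ∣ X ∣ <ᵇ ord n ∣ Z ∣) ∧ (ord n ∣ X ∣ <ᵇ ord n ∣ Y ∣)
      ≡⟨ <ᵇ-∧-redundant _ _ _ (order-inherited n (+ α N) (+ γ N) (+ e N) X Y Z α-odd γ-even relation) ⟩
    (ord n ∣ X ∣ <ᵇ ord n ∣ Y ∣) ∎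
    where
    open ≡-Reasoning
    shifted : ∀ {M W} → M ≡ P2 k * W → ord (k Nat.+ n) ∣ M ∣ ≡ k Nat.+ ord n ∣ W ∣
    shifted {W = W} refl = ord-shift k n W
    relation : + α N * Z ≡ + γ N * X - + e N * Y
    relation = IntP.*-cancelˡ-≡ (P2 k) _ _ {{NatP.m^n≢0 2 k}} (begin
      P2 k * (+ α N * Z)                     ≡⟨ swap (P2 k) (+ α N) Z ⟩
      + α N * (P2 k * Z)                     ≡⟨ cong (+ α N *_) (sym A≡) ⟩
      + α N * Aᴹ N                           ≡⟨ minor-relation-α N ⟩
      + γ N * Bᴹ N - + e N * Cᴹ N            ≡⟨ cong₂ (λ b c → + γ N * b - + e N * c) B≡ C≡ ⟩
      + γ N * (P2 k * X) - + e N * (P2 k * Y) ≡⟨ factor (P2 k) (+ γ N) (+ e N) X Y ⟩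
      P2 k * (+ γ N * X - + e N * Y)          ∎)
      where
      swap : ∀ q a z → q * (a * z) ≡ a * (q * z)
      swap = solve-∀
      factor : ∀ q g e x y → g * (q * x) - e * (q * y) ≡ q * (g * x - e * y)
      factor = solve-∀

  -- The part of a lifted minor that does not depend on the last lift parameter T₆.
  liftOffset : (a b e f q x T₁ T₂ T₅ : ℤ) → ℤ
  liftOffset a b e f q x T₁ T₂ T₅ = x + (f * T₁ - b * T₅ - e * T₂ - q * T₂ * T₅)

  -- Lifting a minor a·f − b·e = x·q whose entries move by q·T: the result is q times an
  -- affine function of T₆ whose slope is the lifted entry a + q·T₁.
  lifted-minor : ∀ a b e f q x T₁ T₂ T₅ T₆ → a * f - b * e ≡ x * q →
    (a + q * T₁) * (f + q * T₆) - (b + q * T₂) * (e + q * T₅)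
      ≡ q * (liftOffset a b e f q x T₁ T₂ T₅ + (a + q * T₁) * T₆)
  lifted-minor a b e f q x T₁ T₂ T₅ T₆ eq = begin
    (a + q * T₁) * (f + q * T₆) - (b + q * T₂) * (e + q * T₅)  ≡⟨ expand a b e f q T₁ T₂ T₅ T₆ ⟩
    (a * f - b * e) + q * (r + (a + q * T₁) * T₆)             ≡⟨ cong (_+ q * (r + (a + q * T₁) * T₆)) eq ⟩
    x * q + q * (r + (a + q * T₁) * T₆)                       ≡⟨ collect x q r ((a + q * T₁) * T₆) ⟩
    q * (liftOffset a b e f q x T₁ T₂ T₅ + (a + q * T₁) * T₆) ∎
    where
    open ≡-Reasoning
    r = f * T₁ - b * T₅ - e * T₂ - q * T₂ * T₅
    expand : ∀ a b e f q T₁ T₂ T₅ T₆ →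
      (a + q * T₁) * (f + q * T₆) - (b + q * T₂) * (e + q * T₅)
        ≡ (a * f - b * e) + q * ((f * T₁ - b * T₅ - e * T₂ - q * T₂ * T₅) + (a + q * T₁) * T₆)
    expand = solve-∀
    collect : ∀ x q r s → x * q + q * (r + s) ≡ q * ((x + r) + s)
    collect = solve-∀

  lift-entry : ∀ q x t → + (x Nat.+ q Nat.* t) ≡ + x + + q * + t
  lift-entry q x t = trans (IntP.pos-+ x (q Nat.* t)) (cong (_+_ (+ x)) (IntP.pos-* q t))

  minor-cong : ∀ {a b c d a' b' c' d' : ℤ} → a ≡ a' → b ≡ b' → c ≡ c' → d ≡ d' →
               a * b - c * d ≡ a' * b' - c' * d'
  minor-cong refl refl refl refl = refl

MinorsVanish : ℕ → Mat0 → Set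
MinorsVanish k M = (+ (2 ^ k) ∣ Aᴹ M) × (+ (2 ^ k) ∣ Bᴹ M) × (+ (2 ^ k) ∣ Cᴹ M)

-- Lifts are parametrised by
-- t₁ … t₆ < 2^n; the minors of a lift are 2^(k+1)·(Z, X + U·t₆, Y + U·t₄) with
-- U = α + 2^(k+1)·t₁ odd and X, Y independent of t₆, t₄.  By equidistribution
-- the sums over t₆ and t₄ count the pairs (X', Y') ∈ (ℤ/2^n)² with ord X' < ord Y'.
module OddCorner (k : ℕ) (M : Mat0) (α-odd : Odd (α M)) (γ-even : Even (γ M))
                 (vanish : MinorsVanish (suc k) M) where
  open Int using (_+_; _*_; _-_)

  private
    q : ℕ
    q = 2 ^ suc k
    a₀ b₀ g₀ d₀ e₀ f₀ : ℤ
    a₀ = + α M ; b₀ = + β M ; g₀ = + γ M ; d₀ = + δ M ; e₀ = + e M ; f₀ = + f M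
    A₀ : + q ∣ˢ Aᴹ M
    A₀ = Signed.∣ᵤ⇒∣ (proj₁ vanish)
    B₀ : + q ∣ˢ Bᴹ M
    B₀ = Signed.∣ᵤ⇒∣ (proj₁ (proj₂ vanish))
    C₀ : + q ∣ˢ Cᴹ M
    C₀ = Signed.∣ᵤ⇒∣ (proj₂ (proj₂ vanish))

    -- The lifted entry α + q·t₁: the common slope of the progressions below.
    U : ℕ → ℤ
    U t₁ = a₀ + + q * + t₁

    X Y : ℕ → ℕ → ℕ → ℤ
    X t₁ t₂ t₅ = liftOffset a₀ b₀ e₀ f₀ (+ q) (Signed.quotient B₀) (+ t₁) (+ t₂) (+ t₅)
    Y t₁ t₂ t₃ = liftOffset a₀ b₀ g₀ d₀ (+ q) (Signed.quotient C₀) (+ t₁) (+ t₂) (+ t₃)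

    U-odd : ∀ t₁ → Oddℤ (U t₁)
    U-odd t₁ = subst Oddℤ (lift-entry q (α M) t₁) (lift-odd k (α M) t₁ α-odd)

  counted-reduces : ∀ n t₁ t₂ t₃ t₄ t₅ t₆ → counted M (suc k) (suc k Nat.+ n) t₁ t₂ t₃ t₄ t₅ t₆ ≡
    𝟙 (ord n ∣ X t₁ t₂ t₅ + U t₁ * + t₆ ∣ <ᵇ ord n ∣ Y t₁ t₂ t₃ + U t₁ * + t₄ ∣)
  counted-reduces n t₁ t₂ t₃ t₄ t₅ t₆ = cong 𝟙 (cond-reduces (suc k) n (lift M q t₁ t₂ t₃ t₄ t₅ t₆)
    (X t₁ t₂ t₅ + U t₁ * + t₆) (Y t₁ t₂ t₃ + U t₁ * + t₄)
    (liftOffset g₀ d₀ e₀ f₀ (+ q) (Signed.quotient A₀) (+ t₃) (+ t₄) (+ t₅) + (g₀ + + q * + t₃) * + t₆)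
    (lift-odd k (α M) t₁ α-odd) (lift-even k (γ M) t₃ γ-even)
    (trans (minor-cong (entry (γ M) t₃) (entry (f M) t₆) (entry (δ M) t₄) (entry (e M) t₅))
           (lifted-minor g₀ d₀ e₀ f₀ (+ q) (Signed.quotient A₀) (+ t₃) (+ t₄) (+ t₅) (+ t₆) (Signed._∣_.equality A₀)))
    (trans (minor-cong (entry (α M) t₁) (entry (f M) t₆) (entry (β M) t₂) (entry (e M) t₅))
           (lifted-minor a₀ b₀ e₀ f₀ (+ q) (Signed.quotient B₀) (+ t₁) (+ t₂) (+ t₅) (+ t₆) (Signed._∣_.equality B₀)))
    (trans (minor-cong (entry (α M) t₁) (entry (δ M) t₄) (entry (β M) t₂) (entry (γ M) t₃))
           (lifted-minor a₀ b₀ g₀ d₀ (+ q) (Signed.quotient C₀) (+ t₁) (+ t₂) (+ t₃) (+ t₄) (Signed._∣_.equality C₀))))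
    where
    entry : ∀ x t → + (x Nat.+ q Nat.* t) ≡ + x + + q * + t
    entry = lift-entry q

  count : ∀ n → η M (suc k) (suc k Nat.+ n) ≡ 2 ^ n Nat.* (2 ^ n Nat.* (2 ^ n Nat.* (2 ^ n Nat.* orderedPairs n)))
  count n = begin
    Sum⁶ (2 ^ (suc k Nat.+ n Nat.∸ suc k)) (counted M (suc k) (suc k Nat.+ n))
      ≡⟨ cong (λ w → Sum⁶ (2 ^ w) (counted M (suc k) (suc k Nat.+ n))) (NatP.m+n∸m≡n (suc k) n) ⟩
    Sum⁶ L (counted M (suc k) (suc k Nat.+ n))
      ≡⟨ sum-cong L (λ t₁ → sum-cong L λ t₂ → trans (sum-cong L λ t₃ → over-t₄t₅t₆ t₁ t₂ t₃)
                                                     (sum-const L (L Nat.* orderedPairs n)))  ⟩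
    sumBelow L (λ _ → sumBelow L λ _ → L Nat.* (L Nat.* orderedPairs n))
      ≡⟨ trans (sum-cong L (λ _ → sum-const L _)) (sum-const L _) ⟩
    L Nat.* (L Nat.* (L Nat.* (L Nat.* orderedPairs n))) ∎
    where
    open ≡-Reasoning
    L = 2 ^ n
    ordY : ℕ → ℕ → ℕ → ℕ → ℕ
    ordY t₁ t₂ t₃ t₄ = ord n ∣ Y t₁ t₂ t₃ + U t₁ * + t₄ ∣
    over-t₅t₆ : ∀ t₁ t₂ t₃ t₄ → sumBelow L (λ t₅ → sumBelow L (counted M (suc k) (suc k Nat.+ n) t₁ t₂ t₃ t₄ t₅))
                                  ≡ L Nat.* countBelow n (ordY t₁ t₂ t₃ t₄)
    over-t₅t₆ t₁ t₂ t₃ t₄ = trans (sum-cong L λ t₅ →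
        trans (sum-cong L (counted-reduces n t₁ t₂ t₃ t₄ t₅))
              (sum-ord-progression n (λ a → 𝟙 (a <ᵇ ordY t₁ t₂ t₃ t₄)) (X t₁ t₂ t₅) (U t₁) (U-odd t₁)))
      (sum-const L _)
    over-t₄t₅t₆ : ∀ t₁ t₂ t₃ → sumBelow L (λ t₄ → sumBelow L (λ t₅ → sumBelow L (counted M (suc k) (suc k Nat.+ n) t₁ t₂ t₃ t₄ t₅)))
                                ≡ L Nat.* orderedPairs n
    over-t₄t₅t₆ t₁ t₂ t₃ = trans (sum-cong L (over-t₅t₆ t₁ t₂ t₃))
      (trans (sum-ord-progression n (λ c → L Nat.* countBelow n c) (Y t₁ t₂ t₃) (U t₁) (U-odd t₁))
             (ordWeight-scale n L (countBelow n)))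

-- Symmetries: swapping the columns, or rows 1 and 3, preserves η.

Sum⁶-cong : ∀ L {h h' : ℕ → ℕ → ℕ → ℕ → ℕ → ℕ → ℕ} →
  (∀ t₁ t₂ t₃ t₄ t₅ t₆ → h t₁ t₂ t₃ t₄ t₅ t₆ ≡ h' t₁ t₂ t₃ t₄ t₅ t₆) → Sum⁶ L h ≡ Sum⁶ L h'
Sum⁶-cong L h≗h' = sum-cong L λ t₁ → sum-cong L λ t₂ → sum-cong L λ t₃ →
  sum-cong L λ t₄ → sum-cong L λ t₅ → sum-cong L λ t₆ → h≗h' t₁ t₂ t₃ t₄ t₅ t₆

Sum² : ℕ → (ℕ → ℕ → ℕ) → ℕ
Sum² L g = sumBelow L λ a → sumBelow L λ b → g a b

Sum²-swap : ∀ L (h : ℕ → ℕ → ℕ → ℕ → ℕ) →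
  Sum² L (λ a b → Sum² L (h a b)) ≡ Sum² L (λ c d → Sum² L (λ a b → h a b c d))
Sum²-swap L h =
  trans (sum-cong L (λ a → sum-swap L L (λ b c → sumBelow L (h a b c))))
  (trans (sum-swap L L (λ a c → sumBelow L (λ b → sumBelow L (h a b c))))
  (trans (sum-cong L (λ c → sum-cong L (λ a → sum-swap L L (λ b → h a b c))))
         (sum-cong L (λ c → sum-swap L L (λ a d → sumBelow L (λ b → h a b c d))))))

Sum⁶-swapOuter : ∀ L (h : ℕ → ℕ → ℕ → ℕ → ℕ → ℕ → ℕ) →
  Sum⁶ L (λ t₁ t₂ t₃ t₄ t₅ t₆ → h t₅ t₆ t₃ t₄ t₁ t₂) ≡ Sum⁶ L h
Sum⁶-swapOuter L h =
  trans (Sum²-swap L (λ x₁ x₂ y₁ y₂ → Sum² L (λ z₁ z₂ → h z₁ z₂ y₁ y₂ x₁ x₂)))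
  (trans (sum-cong L (λ y₁ → sum-cong L (λ y₂ → Sum²-swap L (λ x₁ x₂ z₁ z₂ → h z₁ z₂ y₁ y₂ x₁ x₂))))
         (Sum²-swap L (λ y₁ y₂ z₁ z₂ → Sum² L (λ x₁ x₂ → h z₁ z₂ y₁ y₂ x₁ x₂))))

Sum⁶-swapPairs : ∀ L (h : ℕ → ℕ → ℕ → ℕ → ℕ → ℕ → ℕ) →
  Sum⁶ L (λ t₁ t₂ t₃ t₄ t₅ t₆ → h t₂ t₁ t₄ t₃ t₆ t₅) ≡ Sum⁶ L h
Sum⁶-swapPairs L h =
  trans (sum-cong L λ t₁ → sum-cong L λ t₂ → sum-cong L λ t₃ → sum-cong L λ t₄ →
           sum-swap L L (λ t₅ t₆ → h t₂ t₁ t₄ t₃ t₆ t₅))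
  (trans (sum-cong L λ t₁ → sum-cong L λ t₂ →
           sum-swap L L (λ t₃ t₄ → Sum² L (λ t₅ t₆ → h t₂ t₁ t₄ t₃ t₅ t₆)))
         (sum-swap L L (λ t₁ t₂ → Sum² L (λ t₃ t₄ → Sum² L (λ t₅ t₆ → h t₂ t₁ t₃ t₄ t₅ t₆)))))

swapColumns swapRows : Mat0 → Mat0
swapColumns M = mat (β M) (α M) (δ M) (γ M) (f M) (e M)
swapRows    M = mat (e M) (f M) (γ M) (δ M) (α M) (β M)

module _ where
  open Int using (_+_; _*_; _-_)

  ∣-∣-neg : ∀ {x y} → x ≡ - y → ∣ x ∣ ≡ ∣ y ∣
  ∣-∣-neg {y = y} refl = IntP.∣-i∣≡∣i∣ y

  -- Swapping columns negates A, B, C; swapping rows 1 and 3 negates them and exchanges A, C.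
  swapColumns-minors : ∀ M → ∣ Aᴹ (swapColumns M) ∣ ≡ ∣ Aᴹ M ∣ × ∣ Bᴹ (swapColumns M) ∣ ≡ ∣ Bᴹ M ∣
                                                             × ∣ Cᴹ (swapColumns M) ∣ ≡ ∣ Cᴹ M ∣
  swapColumns-minors M = ∣-∣-neg (negated (+ γ M) (+ f M) (+ δ M) (+ e M))
                       , ∣-∣-neg (negated (+ α M) (+ f M) (+ β M) (+ e M))
                       , ∣-∣-neg (negated (+ α M) (+ δ M) (+ β M) (+ γ M))
    where negated : ∀ a b c d → c * d - a * b ≡ - (a * b - c * d)
          negated = solve-∀

  swapRows-minors : ∀ M → ∣ Aᴹ (swapRows M) ∣ ≡ ∣ Cᴹ M ∣ × ∣ Bᴹ (swapRows M) ∣ ≡ ∣ Bᴹ M ∣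
                                                       × ∣ Cᴹ (swapRows M) ∣ ≡ ∣ Aᴹ M ∣
  swapRows-minors M = ∣-∣-neg (negated (+ α M) (+ β M) (+ γ M) (+ δ M))
                    , ∣-∣-neg (negated (+ α M) (+ β M) (+ e M) (+ f M))
                    , ∣-∣-neg (negated (+ γ M) (+ δ M) (+ e M) (+ f M))
    where negated : ∀ a b c d → c * b - d * a ≡ - (a * d - b * c)
          negated = solve-∀

-- cond only sees the absolute values of the minors, and is symmetric in A and C.
cond-swapColumns : ∀ K N → cond K (swapColumns N) ≡ cond K N
cond-swapColumns K N with swapColumns-minors N
... | A= , B= , C= = cong₂ _∧_ (cong₂ _<ᵇ_ (cong (ord K) B=) (cong (ord K) A=))
                               (cong₂ _<ᵇ_ (cong (ord K) B=) (cong (ord K) C=))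

cond-swapRows : ∀ K N → cond K (swapRows N) ≡ cond K N
cond-swapRows K N with swapRows-minors N
... | A=C , B= , C=A = trans (cong₂ _∧_ (cong₂ _<ᵇ_ (cong (ord K) B=) (cong (ord K) A=C))
                                      (cong₂ _<ᵇ_ (cong (ord K) B=) (cong (ord K) C=A)))
  (Data.Bool.Properties.∧-comm (ord K ∣ Bᴹ N ∣ <ᵇ ord K ∣ Cᴹ N ∣) (ord K ∣ Bᴹ N ∣ <ᵇ ord K ∣ Aᴹ N ∣))

-- η is invariant under both symmetries: the lifts of the swapped matrix are the
-- swapped lifts, with the lift parameters permuted accordingly.
η-swapColumns : ∀ M k K → η (swapColumns M) k K ≡ η M k K
η-swapColumns M k K = begin
  Sum⁶ L (counted (swapColumns M) k K)
    ≡⟨ Sum⁶-cong L (λ t₁ t₂ t₃ t₄ t₅ t₆ → cong 𝟙 (cond-swapColumns K (lift M (2 ^ k) t₂ t₁ t₄ t₃ t₆ t₅))) ⟩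
  Sum⁶ L (λ t₁ t₂ t₃ t₄ t₅ t₆ → counted M k K t₂ t₁ t₄ t₃ t₆ t₅)
    ≡⟨ Sum⁶-swapPairs L (counted M k K) ⟩
  Sum⁶ L (counted M k K) ∎
  where
  open ≡-Reasoning
  L = 2 ^ (K Nat.∸ k)

η-swapRows : ∀ M k K → η (swapRows M) k K ≡ η M k K
η-swapRows M k K = begin
  Sum⁶ L (counted (swapRows M) k K)
    ≡⟨ Sum⁶-cong L (λ t₁ t₂ t₃ t₄ t₅ t₆ → cong 𝟙 (cond-swapRows K (lift M (2 ^ k) t₅ t₆ t₃ t₄ t₁ t₂))) ⟩
  Sum⁶ L (λ t₁ t₂ t₃ t₄ t₅ t₆ → counted M k K t₅ t₆ t₃ t₄ t₁ t₂)
    ≡⟨ Sum⁶-swapOuter L (counted M k K) ⟩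
  Sum⁶ L (counted M k K) ∎
  where
  open ≡-Reasoning
  L = 2 ^ (K Nat.∸ k)

∣-along : ∀ d {m n : ℕ} → m ≡ n → d NatDivisibility.∣ n → d NatDivisibility.∣ m
∣-along d eq = subst (NatDivisibility._∣_ d) (sym eq)

MinorsVanish-swapColumns : ∀ k M → MinorsVanish k M → MinorsVanish k (swapColumns M)
MinorsVanish-swapColumns k M (A∣ , B∣ , C∣) with swapColumns-minors M
... | A= , B= , C= = ∣-along (2 ^ k) A= A∣ , ∣-along (2 ^ k) B= B∣ , ∣-along (2 ^ k) C= C∣

MinorsVanish-swapRows : ∀ k M → MinorsVanish k M → MinorsVanish k (swapRows M)
MinorsVanish-swapRows k M (A∣ , B∣ , C∣) with swapRows-minors M
... | A=C , B= , C=A = ∣-along (2 ^ k) A=C C∣ , ∣-along (2 ^ k) B= B∣ , ∣-along (2 ^ k) C=A A∣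

μ≡-resp-η : ∀ M M' k {v} → (∀ K → η M' k K ≡ η M k K) → μ≡ M' k v → μ≡ M k v
μ≡-resp-η M M' k {v} η= lim ε ε>0 = proj₁ (lim ε ε>0) , λ K K₀≤K →
  subst (λ c → Rat.∣ (+ c Rat./ den K) {{den-nz K}} Rat.- v ∣ Rat.< ε) (η= K) (proj₂ (lim ε ε>0) K K₀≤K)

module _ where
  open Int using (_+_; _*_; -_)

  toℚᵘ-/ : ∀ i n → toℚᵘ (i Rat./ suc n) ≃ᵘ mkℚᵘ i n
  toℚᵘ-/ i n = normalised (i Rat./ suc n) (begin
    Rat.↥ p * + suc n                         ≡⟨ cong (Rat.↥ p *_) (RatP.↧-/ i (suc n)) ⟨
    Rat.↥ p * (Rat.↧ p * IntGCD.gcd i (+ suc n)) ≡⟨ regroup (Rat.↥ p) (Rat.↧ p) (IntGCD.gcd i (+ suc n)) ⟩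
    Rat.↥ p * IntGCD.gcd i (+ suc n) * Rat.↧ p ≡⟨ cong (_* Rat.↧ p) (RatP.↥-/ i (suc n)) ⟩
    i * Rat.↧ p                               ∎)
    where
    open ≡-Reasoning
    p = i Rat./ suc n
    normalised : ∀ p → Rat.↥ p * + suc n ≡ i * Rat.↧ p → toℚᵘ p ≃ᵘ mkℚᵘ i n
    normalised (Rat.mkℚ _ _ _) eq = Ratᵘ.*≡* eq
    regroup : ∀ a b c → a * (b * c) ≡ a * c * b
    regroup = solve-∀

  -- If a·d + g = b, then a/b is within g/(b·d) of 1/d; so |a/b − 1/d| < ε
  -- as soon as g·den(ε) < b·d.
  unit-fraction-approx : ∀ a b d g (ε : ℚ) .{{_ : Nat.NonZero b}} .{{_ : Nat.NonZero d}} → Rat.Positive ε →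
    a Nat.* d Nat.+ g ≡ b → g Nat.* Rat.↧ₙ ε < b Nat.* d →
    Rat.∣ + a Rat./ b Rat.- + 1 Rat./ d ∣ Rat.< ε
  unit-fraction-approx a (suc b') (suc d') g ε@(Rat.mkℚ +[1+ num ] den' _) _ exact small =
    RatP.toℚᵘ-cancel-< (RatᵘP.<-respˡ-≃ (RatᵘP.≃-sym as-unnormalised) (Ratᵘ.*<* (begin-strict
      + ∣ a′ * + suc d' + - + 1 * + suc b' ∣ * + suc den' ≡⟨ cong (λ z → + ∣ z ∣ * + suc den') numerator ⟩
      + ∣ - + g ∣ * + suc den'                           ≡⟨ cong (λ z → + z * + suc den') (IntP.∣-i∣≡∣i∣ (+ g)) ⟩
      + g * + suc den'                                   ≡⟨ IntP.pos-* g (suc den') ⟨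
      + (g Nat.* suc den')                               <⟨ Int.+<+ (NatP.<-≤-trans small (NatP.m≤n*m (suc b' Nat.* suc d') (suc num))) ⟩
      + (suc num Nat.* (suc b' Nat.* suc d'))            ≡⟨ IntP.pos-* (suc num) (suc b' Nat.* suc d') ⟩
      + suc num * + (suc b' Nat.* suc d')                ∎)))
    where
    open IntP.≤-Reasoning
    a′ = + a
    p = a′ Rat./ suc b'
    t = + 1 Rat./ suc d'
    as-unnormalised : toℚᵘ Rat.∣ p Rat.- t ∣ ≃ᵘ Ratᵘ.∣ mkℚᵘ a′ b' Ratᵘ.+ Ratᵘ.- mkℚᵘ (+ 1) d' ∣
    as-unnormalised = RatᵘP.≃-trans (RatP.toℚᵘ-homo-∣-∣ (p Rat.- t))
      (RatᵘP.∣-∣-cong (RatᵘP.≃-trans (RatP.toℚᵘ-homo-+ p (Rat.- t))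
        (RatᵘP.+-cong (toℚᵘ-/ a′ b') (RatᵘP.≃-trans (RatP.toℚᵘ-homo‿- t) (RatᵘP.-‿cong (toℚᵘ-/ (+ 1) d'))))))
    numerator : a′ * + suc d' + - + 1 * + suc b' ≡ - + g
    numerator = trans (cong (λ w → a′ * + suc d' + - + 1 * w) (sym b≡)) (cancel a′ (+ suc d') (+ g))
      where
      b≡ : a′ * + suc d' + + g ≡ + suc b'
      b≡ = trans (cong (_+ + g) (sym (IntP.pos-* a (suc d')))) (trans (sym (IntP.pos-+ (a Nat.* suc d') g)) (cong +_ exact))
      cancel : ∀ x y z → x * y + - + 1 * (x * y + z) ≡ - z
      cancel = solve-∀

module _ where
  open Nat using (_+_; _*_; _∸_)

  n<2^n : ∀ n → n < 2 ^ n
  n<2^n zero    = s≤s z≤n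
  n<2^n (suc n) = NatP.+-mono-≤-< (NatP.m^n>0 2 n) (subst (n <_) (sym (NatP.+-identityʳ (2 ^ n))) (n<2^n n))

  64^≡ : ∀ m → 64 ^ m ≡ 2 ^ m * 2 ^ m * 2 ^ m * 2 ^ m * 2 ^ m * 2 ^ m
  64^≡ zero    = refl
  64^≡ (suc m) = trans (cong (64 *_) (64^≡ m)) (sixfold (2 ^ m))
    where sixfold : ∀ x → 64 * (x * x * x * x * x * x) ≡ 2 * x * (2 * x) * (2 * x) * (2 * x) * (2 * x) * (2 * x)
          sixfold = NatSolver.solve-∀

  den-shape : ∀ k m → den (suc k + (2 + m)) ≡ 8192 * (64 ^ k * (2 ^ m * 2 ^ m * 2 ^ m * 2 ^ m * 2 ^ m * 2 ^ m))
  den-shape k m = cong (8192 *_) (begin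
    64 ^ (suc k + (2 + m) ∸ 3)   ≡⟨ cong (λ w → 64 ^ (w ∸ 2)) (NatP.+-suc k (suc m)) ⟩
    64 ^ (k + suc m ∸ 1)         ≡⟨ cong (λ w → 64 ^ (w ∸ 1)) (NatP.+-suc k m) ⟩
    64 ^ (k + m)                 ≡⟨ NatP.^-distribˡ-+-* 64 k m ⟩
    64 ^ k * 64 ^ m              ≡⟨ cong (64 ^ k *_) (64^≡ m) ⟩
    64 ^ k * (2 ^ m * 2 ^ m * 2 ^ m * 2 ^ m * 2 ^ m * 2 ^ m) ∎)
    where open ≡-Reasoning

  -- From the count η M (k+1) (k+1+n) = 2^(4n)·orderedPairs n to the limit
  -- 1/(6·64^k): at level K = k+1+n the error 1/(6·64^k) − η/den K is 1/(6·64^k·4^n).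
  module Limit (k : ℕ) (M : Mat0)
    (count : ∀ n → η M (suc k) (suc k + n) ≡ 2 ^ n * (2 ^ n * (2 ^ n * (2 ^ n * orderedPairs n)))) where

    private
      P : ℕ
      P = 64 ^ k
      instance
        P≢0 : Nat.NonZero P
        P≢0 = NatP.m^n≢0 64 k

      level : ℕ → ℕ
      level m = suc k + (2 + m)

      gap : ℕ → ℕ
      gap m = 2 * P * (L * (L * (L * L))) where L = 2 ^ (2 + m)

    -- η·6P + g = den K, by 3·orderedPairs (m+2) + 1 = L².
    exact : ∀ m → η M (suc k) (level m) * (6 * P) + gap m ≡ den (level m)
    exact m = begin
      η M (suc k) (level m) * (6 * P) + gap m                  ≡⟨ cong (λ c → c * (6 * P) + gap m) (count (2 + m)) ⟩
      L * (L * (L * (L * orderedPairs (2 + m)))) * (6 * P) + gap m ≡⟨ factor L P (orderedPairs (2 + m)) ⟩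
      gap m * (3 * orderedPairs (2 + m) + 1)                   ≡⟨ cong (gap m *_) (orderedPairs-closed (2 + m)) ⟩
      gap m * (L * L)                                          ≡⟨ expand P (2 ^ m) ⟩
      8192 * (P * (l * l * l * l * l * l))                     ≡⟨ den-shape k m ⟨
      den (level m)                                            ∎
      where
      open ≡-Reasoning
      l = 2 ^ m
      L = 2 ^ (2 + m)
      factor : ∀ L P F → L * (L * (L * (L * F))) * (6 * P) + 2 * P * (L * (L * (L * L)))
                           ≡ 2 * P * (L * (L * (L * L))) * (3 * F + 1)
      factor = NatSolver.solve-∀
      expand : ∀ P l → 2 * P * (2 * (2 * l) * (2 * (2 * l) * (2 * (2 * l) * (2 * (2 * l)))))
                         * (2 * (2 * l) * (2 * (2 * l))) ≡ 8192 * (P * (l * l * l * l * l * l))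
      expand = NatSolver.solve-∀

    -- g·D < den K·6P for every D ≤ m, since den K·6P = g·96P·l² and D < 2^m = l.
    gap-small : ∀ m D → D ≤ m → gap m * D < den (level m) * (6 * P)
    gap-small m D D≤m = subst (gap m * D <_) (sym (trans (cong (_* (6 * P)) (den-shape k m)) (regroup P l)))
      (NatP.*-monoʳ-< (gap m) {{gap≢0}} (NatP.<-≤-trans (NatP.≤-<-trans D≤m (n<2^n m))
        (NatP.m≤n*m l (96 * P * l) {{NatP.m*n≢0 (96 * P) l {{NatP.m*n≢0 96 P}} {{NatP.m^n≢0 2 m}}}})))
      where
      l = 2 ^ m
      L = 2 ^ (2 + m)
      L≢0 : Nat.NonZero L
      L≢0 = NatP.m^n≢0 2 (2 + m)
      gap≢0 : Nat.NonZero (gap m)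
      gap≢0 = NatP.m*n≢0 (2 * P) _ {{NatP.m*n≢0 2 P}}
        {{NatP.m*n≢0 L _ {{L≢0}} {{NatP.m*n≢0 L _ {{L≢0}} {{NatP.m*n≢0 L L {{L≢0}} {{L≢0}}}}}}}}
      regroup : ∀ P l → 8192 * (P * (l * l * l * l * l * l)) * (6 * P)
        ≡ 2 * P * (2 * (2 * l) * (2 * (2 * l) * (2 * (2 * l) * (2 * (2 * l))))) * (96 * P * l * l)
      regroup = NatSolver.solve-∀

    estimate : ∀ ε → Rat.Positive ε → ∀ m → Rat.↧ₙ ε ≤ m →
      Rat.∣ ratio M (suc k) (level m) Rat.- target (suc k) ∣ Rat.< ε
    estimate ε ε>0 m D≤m = unit-fraction-approx (η M (suc k) (level m)) (den (level m)) (6 * P) (gap m) ε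
      {{den-nz (level m)}} {{NatP.m*n≢0 6 P}} ε>0 (exact m) (gap-small m (Rat.↧ₙ ε) D≤m)

    limit : μ≡ M (suc k) (target (suc k))
    limit ε ε>0 = D + (3 + k) , λ K K₀≤K →
      subst (λ K → Rat.∣ ratio M (suc k) K Rat.- target (suc k) ∣ Rat.< ε) (K≡ K K₀≤K)
            (estimate ε ε>0 (K ∸ (3 + k)) (NatP.m+n≤o⇒m≤o∸n D K₀≤K))
      where
      D = Rat.↧ₙ ε
      K≡ : ∀ K → D + (3 + k) ≤ K → suc k + (2 + (K ∸ (3 + k))) ≡ K
      K≡ K K₀≤K = trans (cong suc (trans (NatP.+-suc k (suc m)) (cong suc (NatP.+-suc k m))))
                        (NatP.m+[n∸m]≡n (NatP.m+n≤o⇒n≤o D K₀≤K))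
        where m = K ∸ (3 + k)

density-zero : ∀ k M → Odd (γ M) ⊎ Odd (δ M) → μ≡ M (suc k) 0ℚ
density-zero k M γδ-odd ε ε>0 = 0 , λ K _ →
  subst (λ r → Rat.∣ r Rat.- 0ℚ ∣ Rat.< ε)
        (sym (trans (cong (λ c → (+ c Rat./ den K) {{den-nz K}}) (η-vanishes k M K γδ-odd)) (RatP.0/n≡0 (den K) {{den-nz K}})))
        (RatP.positive⁻¹ ε {{ε>0}})

density-α-odd : ∀ k M → Odd (α M) → Even (γ M) → MinorsVanish (suc k) M → μ≡ M (suc k) (target (suc k))
density-α-odd k M α-odd γ-even vanish = Limit.limit k M (OddCorner.count k M α-odd γ-even vanish)

density-odd-entry : ∀ k M → MinorsVanish (suc k) M → Even (γ M) → Even (δ M) →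
  Odd (α M) ⊎ Odd (β M) ⊎ Odd (e M) ⊎ Odd (f M) → μ≡ M (suc k) (target (suc k))
density-odd-entry k M vanish γ-even δ-even (inj₁ α-odd) = density-α-odd k M α-odd γ-even vanish
density-odd-entry k M vanish γ-even δ-even (inj₂ (inj₁ β-odd)) =
  μ≡-resp-η M (swapColumns M) (suc k) (η-swapColumns M (suc k))
    (density-α-odd k (swapColumns M) β-odd δ-even (MinorsVanish-swapColumns (suc k) M vanish))
density-odd-entry k M vanish γ-even δ-even (inj₂ (inj₂ (inj₁ e-odd))) =
  μ≡-resp-η M (swapRows M) (suc k) (η-swapRows M (suc k))
    (density-α-odd k (swapRows M) e-odd γ-even (MinorsVanish-swapRows (suc k) M vanish))
density-odd-entry k M vanish γ-even δ-even (inj₂ (inj₂ (inj₂ f-odd))) =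
  μ≡-resp-η M (swapRows (swapColumns M)) (suc k)
    (λ K → trans (η-swapRows (swapColumns M) (suc k) K) (η-swapColumns M (suc k) K))
    (density-α-odd k (swapRows (swapColumns M)) f-odd δ-even
       (MinorsVanish-swapRows (suc k) (swapColumns M) (MinorsVanish-swapColumns (suc k) M vanish)))

-- Over ℤ/2⁰ every entry is 0, so nothing is odd.
no-odd-below-1 : ∀ {x} → x < 1 → Odd x → ⊥
no-odd-below-1 {zero}  _         ()
no-odd-below-1 {suc _} (s≤s ()) _

theorem5p4 : (k : ℕ) (M : Mat0) → InRange k M →
    (+ (2 ^ k)) ∣ Aᴹ M → (+ (2 ^ k)) ∣ Bᴹ M → (+ (2 ^ k)) ∣ Cᴹ M →
    ((Odd (γ M) ⊎ Odd (δ M)) → μ≡ M k 0ℚ)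
    × (Even (γ M) → Even (δ M) →
       (Odd (α M) ⊎ Odd (β M) ⊎ Odd (e M) ⊎ Odd (f M)) → μ≡ M k (target k))
theorem5p4 zero M (α<1 , β<1 , γ<1 , δ<1 , e<1 , f<1) _ _ _ =
  [ ⊥-elim ∘ no-odd-below-1 γ<1 , ⊥-elim ∘ no-odd-below-1 δ<1 ]′ ,
  λ _ _ → [ ⊥-elim ∘ no-odd-below-1 α<1 , [ ⊥-elim ∘ no-odd-below-1 β<1 ,
          [ ⊥-elim ∘ no-odd-below-1 e<1 , ⊥-elim ∘ no-odd-below-1 f<1 ]′ ]′ ]′
theorem5p4 (suc k) M _ A∣ B∣ C∣ = density-zero k M , density-odd-entry k M (A∣ , B∣ , C∣)
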